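{- Let $\varepsilon>0$. Let $A\subseteq[N]$ be a multiset and let $B$ be a set of pairwise coprime prime powers such that, for each $b\in B$, the members of $\Sigma^*(A)$ do not run over all residue classes modulo $b$. If $\sum_{b\in B}\Lambda(b)>(1+\varepsilon)\log N$, then $|A|\le(1+\varepsilon^{ -1})\max_{b\in B}b$.
   Context: $[N]=\{1,\dots,N\}$. For a multiset $A=\{a_1,\dots,a_d\}$, $\Sigma^*(A)=\{\sum_i\varepsilon_ia_i:\varepsilon_i\in\{0,1\},\sum_i\varepsilon_i>0\}$, and $|A|$ counts multiplicity. $\Lambda$ is the von Mangoldt function.
   Formalization: The parameter ε ranges over the positive rationals. -}

module Defs where

open import Data.Nat.Base using (ℕ; _≤_; _<_; _^_; _⊔_; ∣_-_∣)
open import Data.Nat.Divisibility using (_∣_)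
open import Data.Nat.Primality using (Prime)
open import Data.List.Base using (List; []; _∷_; foldr)
open import Data.Nat.ListAction using (sum)
open import Data.List.Relation.Binary.Sublist.Propositional using (_⊆_)
open import Data.Product using (Σ; _×_; ∃)
open import Data.Sum using (_⊎_)
open import Relation.Nullary using (¬_)
open import Relation.Binary.PropositionalEquality using (_≡_; _≢_)

IsPrimePower : ℕ → Set
IsPrimePower n = Σ ℕ λ p → Σ ℕ λ k → Prime p × 1 ≤ k × n ≡ p ^ k

-- ExpΛ n m  :⇔  m = exp(Λ(n))  (von Mangoldt): m = p if n = p^k (k ≥ 1), m = 1 otherwise.
ExpΛ : ℕ → ℕ → Set
ExpΛ n m = (Prime m × Σ ℕ λ k → 1 ≤ k × n ≡ m ^ k) ⊎ (¬ IsPrimePower n × m ≡ 1)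

-- A multiset A ⊆ [N], given as a list: every element lies in {1,…,N}
data InRange (N : ℕ) : List ℕ → Set where
  []  : InRange N []
  _∷_ : ∀ {a as} → 1 ≤ a × a ≤ N → InRange N as → InRange N (a ∷ as)

-- x ∈ Σ*(A): x is the sum of a nonempty sub-multiset of A (sub-multisets = sublists)
NonEmpty : List ℕ → Set
NonEmpty xs = xs ≢ []

InΣ* : List ℕ → ℕ → Set
InΣ* A x = Σ (List ℕ) λ s → s ⊆ A × NonEmpty s × sum s ≡ x

MissesResidue : List ℕ → ℕ → Set
MissesResidue A b = Σ ℕ λ r → ∀ x → InΣ* A x → ¬ (b ∣ ∣ x - r ∣)

maxL : List ℕ → ℕ
maxL = foldr _⊔_ 0

{-# OPTIONS --safe #-}
-- Let b = ℓ ^ k be in B, ℓ prime. The elements of A not divisible by ℓ are units modulo b,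
-- and b + 1 of them, u, u₁, …, u_b, already make Σ*(A) meet every class: adding u₁, …, u_b
-- one at a time, the set of residues of their subset sums either gains a new element or
-- is closed under adding a unit, hence is everything; u plus a suitable subset sum then
-- lands in any prescribed class. So at least |A| − max B elements of A are divisible by ℓ.
-- As the primes ℓ are distinct, the product P of them satisfies
-- P ^ (|A| − max B) ≤ ∏_ℓ ℓ ^ #{a ∈ A : ℓ ∣ a} ≤ ∏_{a ∈ A} a ≤ N ^ |A|,
-- and comparing with P ^ q > N ^ (q + p) gives p |A| ≤ (p + q) max B.
module Submission where

open import Defs
open import Data.Nat.Base using (ℕ; _≤_; _<_; _+_; _*_; _^_)
open import Data.Nat.Coprimality using (Coprime)
open import Data.List.Base using (List; length)
open import Data.Nat.ListAction using (product)
open import Data.List.Relation.Unary.All using (All)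
open import Data.List.Relation.Unary.AllPairs using (AllPairs)
open import Data.List.Relation.Binary.Pointwise using (Pointwise)

open import Function.Base using (_∘_; flip)
open import Data.Product using (_×_; _,_; proj₁; proj₂; ∃-syntax)
open import Data.Sum using (_⊎_; inj₁; inj₂)
open import Relation.Nullary using (¬_; yes; no; contradiction)
open import Relation.Unary using (Pred; Decidable)
open import Relation.Unary.Properties using (∁?)
open import Relation.Binary.Definitions using (_Respects₂_)
open import Relation.Binary.PropositionalEquality
  using (_≡_; _≢_; refl; sym; trans; cong; cong₂; subst; module ≡-Reasoning)

open import Data.Nat.Base using (zero; suc; pred; NonZero; >-nonZero; ∣_-_∣; z≤n; s≤s)
open import Data.Nat.Properties
open import Data.Nat.DivMod using (_%_; _/_; m≡m%n+[m/n]*n; %-distribˡ-+; %-distribˡ-*;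
  [m+kn]%n≡m%n; %-remove-+ʳ; m%n%n≡m%n; m%n<n; m<n⇒m%n≡m)
open import Data.Nat.Divisibility
  using (_∣_; _∣?_; divides-refl; ∣-trans; ∣-reflexive; 1∣_; ∣⇒≤;
         m∣m*n; n∣m*n; *-pres-∣; *-monoʳ-∣)
import Data.Nat.Coprimality as Coprimality
open import Data.Nat.Coprimality using (coprime-Bézout; coprime-divisor; 1-coprimeTo)
open import Data.Nat.GCD using (module Bézout)
open import Data.Nat.Primality using (Prime; prime⇒irreducible; prime⇒nonZero)
open import Data.Nat.ListAction using (sum)
open import Data.Nat.ListAction.Properties using (product≢0)
open import Data.Nat.Tactic.RingSolver using (solve-∀)
open import Data.List.Base using ([]; _∷_; map; filter)
open import Data.List.Properties using (length-downFrom; length-removeAt′)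
import Data.List.Relation.Unary.All as All
open import Data.List.Relation.Unary.All using ([]; _∷_)
open import Data.List.Relation.Unary.All.Properties using (¬Any⇒All¬; ¬All⇒Any¬; all-filter)
open import Data.List.Relation.Unary.Any using (here; there)
open import Data.List.Relation.Unary.AllPairs using ([]; _∷_)
import Data.List.Relation.Unary.AllPairs.Properties as AllPairs
open import Data.List.Relation.Unary.Unique.Propositional using (Unique)
open import Data.List.Relation.Binary.Pointwise using ([]; _∷_; AllPairs-resp-Pointwise)
import Data.List.Relation.Binary.Pointwise as Pointwise
open import Data.List.Membership.Propositional using (_∈_; _─_; find)
open import Data.List.Membership.Propositional.Properties using (∈-downFrom⁺)
open import Data.List.Membership.DecPropositional _≟_ using (_∈?_)
open import Data.List.Relation.Binary.Sublist.Propositional using (_⊆_; []; _∷_; _∷ʳ_; ⊆-trans)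
open import Data.List.Relation.Binary.Sublist.Propositional.Properties using (filter-⊆)

module _ {b : ℕ} .{{_ : NonZero b}} where
  open ≡-Reasoning

  +-cong-% : ∀ {m m′ n n′} → m % b ≡ m′ % b → n % b ≡ n′ % b → (m + n) % b ≡ (m′ + n′) % b
  +-cong-% {m} {m′} {n} {n′} m≡m′ n≡n′ = begin
    (m + n) % b            ≡⟨ %-distribˡ-+ m n b ⟩
    (m % b + n % b) % b    ≡⟨ cong₂ (λ u v → (u + v) % b) m≡m′ n≡n′ ⟩
    (m′ % b + n′ % b) % b  ≡⟨ %-distribˡ-+ m′ n′ b ⟨
    (m′ + n′) % b          ∎

  *-cong-% : ∀ {m m′ n n′} → m % b ≡ m′ % b → n % b ≡ n′ % b → (m * n) % b ≡ (m′ * n′) % b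
  *-cong-% {m} {m′} {n} {n′} m≡m′ n≡n′ = begin
    (m * n) % b            ≡⟨ %-distribˡ-* m n b ⟩
    (m % b * (n % b)) % b  ≡⟨ cong₂ (λ u v → (u * v) % b) m≡m′ n≡n′ ⟩
    (m′ % b * (n′ % b)) % b ≡⟨ %-distribˡ-* m′ n′ b ⟨
    (m′ * n′) % b          ∎

  -- pred b * n stands for -n modulo b, which avoids truncated subtraction.
  [m+pred[b]*n+n]%b≡m%b : ∀ m n → (m + pred b * n + n) % b ≡ m % b
  [m+pred[b]*n+n]%b≡m%b m n = begin
    (m + pred b * n + n) % b      ≡⟨ cong (_% b) (rearrange m (pred b) n) ⟩
    (m + suc (pred b) * n) % b    ≡⟨ cong (λ c → (m + c * n) % b) (suc-pred b) ⟩
    (m + b * n) % b               ≡⟨ %-remove-+ʳ m (m∣m*n n) ⟩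
    m % b                         ∎
    where
    rearrange : ∀ m c n → m + c * n + n ≡ m + (1 + c) * n
    rearrange = solve-∀

  %≡%⇒∣∣-∣ : ∀ m n → m % b ≡ n % b → b ∣ ∣ m - n ∣
  %≡%⇒∣∣-∣ m n m≡n = subst (b ∣_) (sym ∣m-n∣≡∣m/b-n/b∣*b) (n∣m*n ∣ m / b - n / b ∣)
    where
    ∣m-n∣≡∣m/b-n/b∣*b : ∣ m - n ∣ ≡ ∣ m / b - n / b ∣ * b
    ∣m-n∣≡∣m/b-n/b∣*b = begin
      ∣ m - n ∣                                 ≡⟨ cong₂ ∣_-_∣ (m≡m%n+[m/n]*n m b) (m≡m%n+[m/n]*n n b) ⟩
      ∣ m % b + m / b * b - n % b + n / b * b ∣ ≡⟨ cong (λ r → ∣ m % b + m / b * b - r + n / b * b ∣) m≡n ⟨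
      ∣ m % b + m / b * b - m % b + n / b * b ∣ ≡⟨ ∣m+n-m+o∣≡∣n-o∣ (m % b) _ _ ⟩
      ∣ m / b * b - n / b * b ∣                 ≡⟨ *-distribʳ-∣-∣ b (m / b) (n / b) ⟨
      ∣ m / b - n / b ∣ * b                     ∎

  coprime⇒∃inverse : ∀ {a} → Coprime a b → ∃[ x ] (x * a) % b ≡ 1 % b
  coprime⇒∃inverse {a} a⊥b with coprime-Bézout a⊥b
  ... | Bézout.+- x y 1+yb≡xa = x , (begin
    (x * a) % b      ≡⟨ cong (_% b) 1+yb≡xa ⟨
    (1 + y * b) % b  ≡⟨ [m+kn]%n≡m%n 1 y b ⟩
    1 % b            ∎)
  ... | Bézout.-+ x y 1+xa≡yb = pred b * x , (begin
    (pred b * x * a) % b                  ≡⟨ cong (_% b) (*-assoc (pred b) x a) ⟩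
    (pred b * (x * a)) % b                ≡⟨ %-remove-+ʳ _ (n∣m*n y) ⟨
    (pred b * (x * a) + y * b) % b        ≡⟨ cong (λ c → (pred b * (x * a) + c) % b) 1+xa≡yb ⟨
    (pred b * (x * a) + (1 + x * a)) % b  ≡⟨ cong (_% b) (rearrange (pred b) (x * a)) ⟩
    (1 + pred b * (x * a) + x * a) % b    ≡⟨ [m+pred[b]*n+n]%b≡m%b 1 (x * a) ⟩
    1 % b                                 ∎)
    where
    rearrange : ∀ c n → c * n + (1 + n) ≡ 1 + c * n + n
    rearrange = solve-∀

  coprime⇒solvable : ∀ {a} → Coprime a b → ∀ m n → ∃[ k ] (k * a + m) % b ≡ n % b
  coprime⇒solvable {a} a⊥b m n with coprime⇒∃inverse a⊥b
  ... | x , xa≡1 = c * x , (begin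
    (c * x * a + m) % b    ≡⟨ cong (λ v → (v + m) % b) (*-assoc c x a) ⟩
    (c * (x * a) + m) % b  ≡⟨ +-cong-% (*-cong-% {m = c} refl xa≡1) refl ⟩
    (c * 1 + m) % b        ≡⟨ cong (λ v → (v + m) % b) (*-identityʳ c) ⟩
    (n + pred b * m + m) % b ≡⟨ [m+pred[b]*n+n]%b≡m%b n m ⟩
    n % b                  ∎)
    where
    c : ℕ
    c = n + pred b * m

  -- The orbit of x₀ under x ↦ a + x runs through all residues, as a is invertible mod b.
  closed⇒complete : ∀ {a x₀ U} → Coprime a b → x₀ ∈ U → x₀ < b →
                    (∀ {x} → x ∈ U → (a + x) % b ∈ U) → ∀ n → n % b ∈ U
  closed⇒complete {a} {x₀} {U} a⊥b x₀∈U x₀<b closed n =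
    let k , k*a+x₀≡n = coprime⇒solvable a⊥b x₀ n in subst (_∈ U) k*a+x₀≡n (orbit k)
    where
    orbit : ∀ k → (k * a + x₀) % b ∈ U
    orbit zero    = subst (_∈ U) (sym (m<n⇒m%n≡m x₀<b)) x₀∈U
    orbit (suc k) = subst (_∈ U) step (closed (orbit k))
      where
      step : (a + (k * a + x₀) % b) % b ≡ (suc k * a + x₀) % b
      step = trans (+-cong-% {m = a} refl (m%n%n≡m%n (k * a + x₀) b))
                   (cong (_% b) (sym (+-assoc a (k * a) x₀)))

∈-─⁺ : ∀ {a} {A : Set a} {x y : A} {ys} (x∈ys : x ∈ ys) → y ∈ ys → x ≢ y → y ∈ ys ─ x∈ys
∈-─⁺ (here refl)  (here refl)  x≢y = contradiction refl x≢y
∈-─⁺ (here refl)  (there y∈ys) _   = y∈ys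
∈-─⁺ (there _)    (here refl)  _   = here refl
∈-─⁺ (there x∈ys) (there y∈ys) x≢y = there (∈-─⁺ x∈ys y∈ys x≢y)

unique⇒length≤ : ∀ {a} {A : Set a} {xs ys : List A} → Unique xs → All (_∈ ys) xs →
                 length xs ≤ length ys
unique⇒length≤ [] [] = z≤n
unique⇒length≤ {xs = _ ∷ xs} {ys} (x∉xs ∷ uniq) (x∈ys ∷ xs⊆ys) = begin
  suc (length xs)          ≤⟨ s≤s (unique⇒length≤ uniq xs⊆ys─x) ⟩
  suc (length (ys ─ x∈ys)) ≡⟨ length-removeAt′ ys _ ⟨
  length ys                ∎
  where
  open ≤-Reasoning
  xs⊆ys─x : All (_∈ ys ─ x∈ys) xs
  xs⊆ys─x = All.zipWith (λ (x≢y , y∈ys) → ∈-─⁺ x∈ys y∈ys x≢y) (x∉xs , xs⊆ys)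

unique∧<⇒length≤ : ∀ {n xs} → Unique xs → All (_< n) xs → length xs ≤ n
unique∧<⇒length≤ {n} uniq xs<n =
  subst (_ ≤_) (length-downFrom n) (unique⇒length≤ uniq (All.map ∈-downFrom⁺ xs<n))

module SubsetSums (b : ℕ) .{{_ : NonZero b}} where

  Attains : List ℕ → ℕ → Set
  Attains L y = ∃[ s ] s ⊆ L × sum s % b ≡ y

  Covers : List ℕ → Set
  Covers L = ∀ n → Attains L (n % b)

  Grows : List ℕ → Set
  Grows L = Covers L ⊎ ∃[ U ] Unique U × All (Attains L) U × length L < length U

  attains⇒< : ∀ {L y} → Attains L y → y < b
  attains⇒< (s , _ , refl) = m%n<n (sum s) b

  attains-skip : ∀ {a L y} → Attains L y → Attains (a ∷ L) y
  attains-skip {a} (s , s⊆L , eq) = s , a ∷ʳ s⊆L , eq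

  attains-take : ∀ {a L y} → Attains L y → Attains (a ∷ L) ((a + y) % b)
  attains-take {a} (s , s⊆L , refl) =
    a ∷ s , refl ∷ s⊆L , +-cong-% {m = a} refl (sym (m%n%n≡m%n (sum s) b))

  closed⇒covers : ∀ {a L U} → Coprime a b → All (Attains L) U → length L < length U →
                  (∀ {x} → x ∈ U → (a + x) % b ∈ U) → Covers L
  closed⇒covers {U = x₀ ∷ _} a⊥b attained _ closed n =
    All.lookup attained (closed⇒complete a⊥b (here refl) (attains⇒< (All.head attained)) closed n)

  grows-∷ : ∀ {a L} → Coprime a b → Grows L → Grows (a ∷ L)
  grows-∷ a⊥b (inj₁ covers) = inj₁ (attains-skip ∘ covers)
  grows-∷ {a} a⊥b (inj₂ (U , uniq , attained , |L|<|U|))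
    with All.all? (λ x → (a + x) % b ∈? U) U
  ... | yes closed = inj₁ (attains-skip ∘ closed⇒covers a⊥b attained |L|<|U| (All.lookup closed))
  ... | no ¬closed =
    let x , x∈U , new∉U = find (¬All⇒Any¬ (λ x → (a + x) % b ∈? U) U ¬closed)
    in inj₂ ( (a + x) % b ∷ U
            , ¬Any⇒All¬ U new∉U ∷ uniq
            , attains-take (All.lookup attained x∈U) ∷ All.map attains-skip attained
            , s≤s |L|<|U|)

  grows : ∀ {L} → All (λ a → Coprime a b) L → Grows L
  grows []           = inj₂ (0 % b ∷ [] , [] ∷ [] , ([] , [] , refl) ∷ [] , s≤s z≤n)
  grows (a⊥b ∷ L⊥b) = grows-∷ a⊥b (grows L⊥b)

  covers : ∀ {L} → All (λ a → Coprime a b) L → b ≤ length L → Covers L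
  covers L⊥b b≤|L| with grows L⊥b
  ... | inj₁ cov = cov
  ... | inj₂ (U , uniq , attained , |L|<|U|) =
    contradiction (unique∧<⇒length≤ uniq (All.map attains⇒< attained))
                  (<⇒≱ (≤-<-trans b≤|L| |L|<|U|))

coprimeSublist⇒¬MissesResidue : ∀ {b} .{{_ : NonZero b}} {A V} → V ⊆ A →
  All (λ v → Coprime v b) V → b < length V → ¬ MissesResidue A b
coprimeSublist⇒¬MissesResidue {b} {V = u ∷ V} u∷V⊆A (_ ∷ V⊥b) (s≤s b≤|V|) (r , misses)
  with SubsetSums.covers b V⊥b b≤|V| (r + pred b * u)
... | s , s⊆V , s≡r-u =
  misses (u + sum s) (u ∷ s , ⊆-trans (refl ∷ s⊆V) u∷V⊆A , (λ ()) , refl)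
    (%≡%⇒∣∣-∣ (u + sum s) r u+s≡r)
  where
  open ≡-Reasoning
  u+s≡r : (u + sum s) % b ≡ r % b
  u+s≡r = begin
    (u + sum s) % b           ≡⟨ cong (_% b) (+-comm u (sum s)) ⟩
    (sum s + u) % b           ≡⟨ +-cong-% s≡r-u refl ⟩
    (r + pred b * u + u) % b  ≡⟨ [m+pred[b]*n+n]%b≡m%b r u ⟩
    r % b                     ∎

coprime-resp-∣ : Coprime Respects₂ flip _∣_
coprime-resp-∣ = (λ o∣n m⊥n (d∣m , d∣o) → m⊥n (d∣m , ∣-trans d∣o o∣n))
               , (λ o∣m m⊥n (d∣o , d∣n) → m⊥n (∣-trans d∣o o∣m , d∣n))

coprime-*ʳ : ∀ {m n o} → Coprime m n → Coprime m o → Coprime m (n * o)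
coprime-*ʳ m⊥n m⊥o (d∣m , d∣n*o) =
  m⊥o (d∣m , coprime-divisor (λ (e∣d , e∣n) → m⊥n (∣-trans e∣d d∣m , e∣n)) d∣n*o)

coprime-productʳ : ∀ {m ns} → All (Coprime m) ns → Coprime m (product ns)
coprime-productʳ []            = Coprimality.sym (1-coprimeTo _)
coprime-productʳ (m⊥n ∷ m⊥ns) = coprime-*ʳ m⊥n (coprime-productʳ m⊥ns)

coprime-^ʳ : ∀ {m n} → Coprime m n → ∀ k → Coprime m (n ^ k)
coprime-^ʳ m⊥n zero    = Coprimality.sym (1-coprimeTo _)
coprime-^ʳ m⊥n (suc k) = coprime-*ʳ m⊥n (coprime-^ʳ m⊥n k)

∤⇒coprime : ∀ {p n} → Prime p → ¬ p ∣ n → Coprime n p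
∤⇒coprime p-prime p∤n {d} (d∣n , d∣p) with prime⇒irreducible p-prime d∣p
... | inj₁ d≡1 = d≡1
... | inj₂ refl = contradiction d∣n p∤n

coprime-∣⇒*∣ : ∀ {m n o} → Coprime m n → m ∣ o → n ∣ o → m * n ∣ o
coprime-∣⇒*∣ {m} {n} m⊥n (divides-refl q) n∣q*m =
  subst (m * n ∣_) (*-comm m q)
    (*-monoʳ-∣ m (coprime-divisor (Coprimality.sym m⊥n) (subst (n ∣_) (*-comm q m) n∣q*m)))

product-∣ : ∀ {ns o} → AllPairs Coprime ns → All (_∣ o) ns → product ns ∣ o
product-∣ []              []            = 1∣ _
product-∣ (n⊥ns ∷ ns-cop) (n∣o ∷ ns∣o) =
  coprime-∣⇒*∣ (coprime-productʳ n⊥ns) n∣o (product-∣ ns-cop ns∣o)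

length-filter-∁ : ∀ {a p} {A : Set a} {P : Pred A p} (P? : Decidable P) xs →
                  length xs ≡ length (filter P? xs) + length (filter (∁? P?) xs)
length-filter-∁ P? []       = refl
length-filter-∁ P? (x ∷ xs) with P? x
... | yes _ = cong suc (length-filter-∁ P? xs)
... | no  _ = trans (cong suc (length-filter-∁ P? xs)) (sym (+-suc _ _))

count : ℕ → List ℕ → ℕ
count p A = length (filter (p ∣?_) A)

missesResidue⇒length≤count+ : ∀ {p A} k → Prime p → MissesResidue A (p ^ k) →
                               length A ≤ count p A + p ^ k
missesResidue⇒length≤count+ {p} {A} k p-prime misses = begin
  length A                 ≡⟨ length-filter-∁ (p ∣?_) A ⟩
  count p A + length units ≤⟨ +-monoʳ-≤ (count p A) (≮⇒≥ many-units⇒covers) ⟩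
  count p A + p ^ k        ∎
  where
  open ≤-Reasoning
  instance _ = m^n≢0 p k {{prime⇒nonZero p-prime}}
  units : List ℕ
  units = filter (∁? (p ∣?_)) A
  unit⇒coprime : ∀ {u} → ¬ p ∣ u → Coprime u (p ^ k)
  unit⇒coprime p∤u = coprime-^ʳ (∤⇒coprime p-prime p∤u) k
  many-units⇒covers : ¬ p ^ k < length units
  many-units⇒covers many = coprimeSublist⇒¬MissesResidue (filter-⊆ _ A)
    (All.map unit⇒coprime (all-filter _ A)) many misses

∏^count : List ℕ → List ℕ → ℕ
∏^count ps A = product (map (λ p → p ^ count p A) ps)

∏^count-[] : ∀ ps → ∏^count ps [] ≡ 1
∏^count-[] []       = refl
∏^count-[] (_ ∷ ps) = trans (*-identityˡ (∏^count ps [])) (∏^count-[] ps)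

∏^count-∷ : ∀ ps a A → ∏^count ps (a ∷ A) ≡ product (filter (_∣? a) ps) * ∏^count ps A
∏^count-∷ []       a A = refl
∏^count-∷ (p ∷ ps) a A with p ∣? a
... | yes _ = trans (cong (p * p ^ count p A *_) (∏^count-∷ ps a A))
                    (rearrange p (p ^ count p A) (product (filter (_∣? a) ps)) (∏^count ps A))
  where
  rearrange : ∀ p c d g → p * c * (d * g) ≡ p * d * (c * g)
  rearrange = solve-∀
... | no  _ = trans (cong (p ^ count p A *_) (∏^count-∷ ps a A))
                    (rearrange (p ^ count p A) (product (filter (_∣? a) ps)) (∏^count ps A))
  where
  rearrange : ∀ c d g → c * (d * g) ≡ d * (c * g)
  rearrange = solve-∀

∏^count∣product : ∀ {ps} → AllPairs Coprime ps → ∀ A → ∏^count ps A ∣ product A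
∏^count∣product {ps} _      []      = ∣-reflexive (∏^count-[] ps)
∏^count∣product {ps} ps-cop (a ∷ A) = subst (_∣ a * product A) (sym (∏^count-∷ ps a A))
  (*-pres-∣ (product-∣ (AllPairs.filter⁺ (_∣? a) ps-cop) (all-filter (_∣? a) ps))
            (∏^count∣product ps-cop A))

^-distribʳ-* : ∀ m n k → (m * n) ^ k ≡ m ^ k * n ^ k
^-distribʳ-* m n zero    = refl
^-distribʳ-* m n (suc k) = trans (cong (m * n *_) (^-distribʳ-* m n k))
                                 (rearrange m n (m ^ k) (n ^ k))
  where
  rearrange : ∀ m n u v → m * n * (u * v) ≡ m * u * (n * v)
  rearrange = solve-∀

product^≤∏^count : ∀ {ps A e} → All NonZero ps → All (λ p → e ≤ count p A) ps →
                   product ps ^ e ≤ ∏^count ps A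
product^≤∏^count {e = e} [] [] = ≤-reflexive (^-zeroˡ e)
product^≤∏^count {p ∷ ps} {A} {e} (p≢0 ∷ ps≢0) (e≤count ∷ e≤counts) = begin
  (p * product ps) ^ e        ≡⟨ ^-distribʳ-* p (product ps) e ⟩
  p ^ e * product ps ^ e      ≤⟨ *-mono-≤ (^-monoʳ-≤ p {{p≢0}} e≤count)
                                          (product^≤∏^count {A = A} ps≢0 e≤counts) ⟩
  p ^ count p A * ∏^count ps A ∎
  where open ≤-Reasoning

product≤^length : ∀ {N xs} → All (_≤ N) xs → product xs ≤ N ^ length xs
product≤^length []            = ≤-refl
product≤^length (x≤N ∷ xs≤N) = *-mono-≤ x≤N (product≤^length xs≤N)

^-cancelˡ-< : ∀ m .{{_ : NonZero m}} {n o} → m ^ n < m ^ o → n < o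
^-cancelˡ-< m m^n<m^o = ≰⇒> (λ o≤n → <⇒≱ m^n<m^o (^-monoʳ-≤ m o≤n))

exponents-< : ∀ {N P} .{{_ : NonZero N}} q p d .{{_ : NonZero d}} {n} →
              N ^ (q + p) < P ^ q → P ^ d ≤ N ^ n → (q + p) * d < n * q
exponents-< {N} {P} q p d {n} N^[q+p]<P^q P^d≤N^n = ^-cancelˡ-< N (begin-strict
  N ^ ((q + p) * d)  ≡⟨ ^-*-assoc N (q + p) d ⟨
  (N ^ (q + p)) ^ d  <⟨ ^-monoˡ-< d N^[q+p]<P^q ⟩
  (P ^ q) ^ d        ≡⟨ ^-*-assoc P q d ⟩
  P ^ (q * d)        ≡⟨ cong (P ^_) (*-comm q d) ⟩
  P ^ (d * q)        ≡⟨ ^-*-assoc P d q ⟨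
  (P ^ d) ^ q        ≤⟨ ^-monoˡ-≤ q P^d≤N^n ⟩
  (N ^ n) ^ q        ≡⟨ ^-*-assoc N n q ⟩
  N ^ (n * q)        ∎)
  where open ≤-Reasoning

p*n<[p+q]*M : ∀ p q {d M n} → d + M ≡ n → (q + p) * d < n * q → p * n < (p + q) * M
p*n<[p+q]*M p q {d} {M} refl [q+p]d<nq = +-cancelˡ-< ((d + M) * q) _ _ (begin-strict
  (d + M) * q + p * (d + M)  ≡⟨ rearrange p q d M ⟩
  (q + p) * d + (p + q) * M  <⟨ +-monoˡ-< ((p + q) * M) [q+p]d<nq ⟩
  (d + M) * q + (p + q) * M  ∎)
  where
  open ≤-Reasoning
  rearrange : ∀ p q d M → (d + M) * q + p * (d + M) ≡ (q + p) * d + (p + q) * M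
  rearrange = solve-∀

log-comparison : ∀ p q {N P n M} .{{_ : NonZero N}} → N ^ (q + p) < P ^ q →
                 (∀ {d} → d + M ≡ n → P ^ d ≤ N ^ n) → p * n ≤ (p + q) * M
log-comparison p q {n = n} {M} N^[q+p]<P^q P^d≤N^n with n ≤? M
... | yes n≤M = ≤-trans (*-monoʳ-≤ p n≤M) (*-monoˡ-≤ M (m≤m+n p q))
... | no  n≰M with m≤n⇒∃[o]m+o≡n (≰⇒> n≰M)
...   | k , 1+M+k≡n = <⇒≤ (p*n<[p+q]*M p q d+M≡n
                             (exponents-< q p (suc k) {n} N^[q+p]<P^q (P^d≤N^n d+M≡n)))
  where
  d+M≡n : suc k + M ≡ n
  d+M≡n = trans (cong suc (+-comm k M)) 1+M+k≡n

PrimePowerOf : ℕ → ℕ → Set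
PrimePowerOf b p = Prime p × ∃[ k ] 1 ≤ k × b ≡ p ^ k

expΛ⇒primePowerOf : ∀ {b p} → IsPrimePower b → ExpΛ b p → PrimePowerOf b p
expΛ⇒primePowerOf _      (inj₁ b≡p^k)     = b≡p^k
expΛ⇒primePowerOf b-ppow (inj₂ (¬ppow , _)) = contradiction b-ppow ¬ppow

primePowersOf : ∀ {B ps} → All IsPrimePower B → Pointwise ExpΛ B ps →
                Pointwise PrimePowerOf B ps
primePowersOf []                []              = []
primePowersOf (b-ppow ∷ B-ppow) (expΛ ∷ expΛs) =
  expΛ⇒primePowerOf b-ppow expΛ ∷ primePowersOf B-ppow expΛs

primePowerOf⇒∣ : ∀ {b p} → PrimePowerOf b p → p ∣ b
primePowerOf⇒∣ (_ , suc k , _ , refl) = m∣m*n _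

All-transport : ∀ {a b r p q} {A : Set a} {B : Set b}
                {R : A → B → Set r} {P : Pred A p} {Q : Pred B q} →
                (∀ {x y} → R x y → P x → Q y) →
                ∀ {xs ys} → Pointwise R xs ys → All P xs → All Q ys
All-transport f []           []         = []
All-transport f (Rxy ∷ Rxys) (px ∷ pxs) = f Rxy px ∷ All-transport f Rxys pxs

maxL-bounds : ∀ xs → All (_≤ maxL xs) xs
maxL-bounds []       = []
maxL-bounds (x ∷ xs) =
  m≤m⊔n x (maxL xs) ∷ All.map (λ y≤max → ≤-trans y≤max (m≤n⊔m x (maxL xs))) (maxL-bounds xs)

inRange⇒All : ∀ {N A} → InRange N A → All (λ a → 1 ≤ a × a ≤ N) A
inRange⇒All []          = []
inRange⇒All (a∈ ∷ A∈) = a∈ ∷ inRange⇒All A∈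

theorem1p6 : (p q : ℕ) → 1 ≤ p → 1 ≤ q →
    (N : ℕ) → 1 ≤ N →
    (A : List ℕ) → InRange N A →
    (B : List ℕ) → All IsPrimePower B → AllPairs Coprime B →
    All (MissesResidue A) B →
    (ps : List ℕ) → Pointwise ExpΛ B ps →
    N ^ (q + p) < product ps ^ q →
    p * length A ≤ (p + q) * maxL B
theorem1p6 p q _ _ N 1≤N A A⊆[N] B B-ppow B-cop misses ps expΛ N^[q+p]<P^q =
  log-comparison p q {{>-nonZero 1≤N}} N^[q+p]<P^q P^d≤N^|A|
  where
  open ≤-Reasoning
  M : ℕ
  M = maxL B
  ppows : Pointwise PrimePowerOf B ps
  ppows = primePowersOf B-ppow expΛ
  ps-cop : AllPairs Coprime ps
  ps-cop = AllPairs-resp-Pointwise coprime-resp-∣ (Pointwise.map primePowerOf⇒∣ ppows) B-cop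
  ps-bounds : All (λ ℓ → Prime ℓ × length A ≤ count ℓ A + M) ps
  ps-bounds = All-transport
    (λ { (ℓ-prime , k , _ , refl) (misses , b≤M) →
         ℓ-prime , ≤-trans (missesResidue⇒length≤count+ k ℓ-prime misses) (+-monoʳ-≤ _ b≤M) })
    ppows (All.zip (misses , maxL-bounds B))
  d≤counts : ∀ {d} → d + M ≡ length A → All (λ ℓ → d ≤ count ℓ A) ps
  d≤counts {d} d+M≡|A| = All.map (λ {ℓ} (_ , |A|≤count+M) →
    +-cancelʳ-≤ M d (count ℓ A) (subst (_≤ count ℓ A + M) (sym d+M≡|A|) |A|≤count+M)) ps-bounds
  A-bounds : All (λ a → 1 ≤ a × a ≤ N) A
  A-bounds = inRange⇒All A⊆[N]
  P^d≤N^|A| : ∀ {d} → d + M ≡ length A → product ps ^ d ≤ N ^ length A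
  P^d≤N^|A| {d} d+M≡|A| = begin
    product ps ^ d  ≤⟨ product^≤∏^count {A = A} (All.map (prime⇒nonZero ∘ proj₁) ps-bounds)
                                                (d≤counts d+M≡|A|) ⟩
    ∏^count ps A    ≤⟨ ∣⇒≤ {{product≢0 (All.map (>-nonZero ∘ proj₁) A-bounds)}}
                           (∏^count∣product ps-cop A) ⟩
    product A       ≤⟨ product≤^length (All.map proj₂ A-bounds) ⟩
    N ^ length A    ∎
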